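{- Let $H=(V,E,W)$ be a hypergraph with weight function $W\colon E\to\mathbb{R}_{>0}$ and rank $d=\max_{e\in E}|e|$, let $\varepsilon\ge 0$, and run the Stack Streaming Algorithm (described in the context) with the update function $\delta_{\mathrm{g}}$ on an arbitrary ordering of $E$. For each hyperedge $e$ let $\Phi_e$ be the value $\sum_{v\in e}\phi_v$ computed when $e$ is scanned (before any update caused by $e$), let $W'_e:=W(e)-\Phi_e$, and let $$\Delta\phi^{e}=\begin{cases}|e|\,(W(e)-\Phi_e) & \text{if } e \text{ was pushed onto the stack},\\ 0 & \text{otherwise.}\end{cases}$$ For a hyperedge $e$ pushed onto the stack, let $\mathcal{P}(e)$ consist of $e$ together with all hyperedges $c$ with $c\cap e\neq\emptyset$ that were pushed onto the stack before $e$. Then for every hyperedge $e$ pushed onto the stack, $$W(e)\;\ge\;\sum_{e'\in\mathcal{P}(e)}\frac{1}{d}\,\Delta\phi^{e'}.$$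
   Context: Stack Streaming Algorithm with parameter $\varepsilon\ge 0$ and update function $\delta_{\mathrm{g}}$: maintain a real dual variable $\phi_v$ for each $v\in V$, initially $0$, and an initially empty stack $S$. The hyperedges of $E$ arrive one by one in an arbitrary order. When $e$ arrives, compute $\Phi_e=\sum_{v\in e}\phi_v$. If $W(e)<(1+\varepsilon)\Phi_e$, discard $e$. Otherwise push $e$ onto $S$ and, for every $v\in e$, set $\phi_v\leftarrow \phi_v+W(e)-\Phi_e$ (this is the update function $\delta_{\mathrm{g}}$; $\Phi_e$ is the value computed before the updates). After the stream ends, set $M=\emptyset$ and pop hyperedges from $S$ one by one (top first); a popped hyperedge $e$ is added to $M$ if it is disjoint from every hyperedge already in $M$. The output is $M$.
   Formalization: The hyperedge weights and the parameter ε are rational rather than real, so the dual variables $\phi_v$ also take rational values. -}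

module Defs where

open import Data.Bool using (Bool; true; false; if_then_else_; _∧_)
open import Data.Nat as ℕ using (ℕ; _⊔_)
open import Data.Integer using (+_)
open import Data.Fin using (Fin; toℕ)
open import Data.Fin.Subset using (Subset; ∣_∣; _∩_; Nonempty)
open import Data.Fin.Subset.Properties using (nonempty?)
open import Data.Vec using (lookup)
open import Data.List using (List; []; _∷_; foldl; foldr; map; take; length; allFin; filter)
import Data.List as L
open import Data.Product using (_×_; _,_; proj₁; proj₂)
open import Data.Rational using (ℚ; 0ℚ; 1ℚ; _+_; _*_; _-_; _≤_; _/_)
open import Data.Rational.Properties using (_≤?_)
open import Relation.Nullary using (does)
open import Relation.Nullary.Decidable using (⌊_⌋)
open import Function using (_∘_)

Edge : ℕ → Set
Edge n = Subset n × ℚ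

Duals : ℕ → Set
Duals n = Fin n → ℚ

ℕtoℚ : ℕ → ℚ
ℕtoℚ k = (+ k) / 1

sumℚ : List ℚ → ℚ
sumℚ = foldr _+_ 0ℚ

Φ : ∀ {n} → Duals n → Subset n → ℚ
Φ {n} φ s = sumℚ (map (λ v → if lookup s v then φ v else 0ℚ) (allFin n))

-- Test of the algorithm: e is pushed iff not (W(e) < (1+ε) Φ_e), i.e. (1+ε) Φ_e ≤ W(e)
pushTest : ∀ {n} → ℚ → Duals n → Edge n → Bool
pushTest ε φ (s , w) = does (((1ℚ + ε) * Φ φ s) ≤? w)

step : ∀ {n} → ℚ → Duals n → Edge n → Duals n
step ε φ (s , w) with pushTest ε φ (s , w)
... | false = φ
... | true  = λ v → if lookup s v then φ v + (w - Φ φ (s)) else φ v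

dualsAfter : ∀ {n} → ℚ → List (Edge n) → Duals n
dualsAfter ε = foldl (step ε) (λ _ → 0ℚ)

module Run {n : ℕ} (ε : ℚ) (stream : List (Edge n)) where

  Pos : Set
  Pos = Fin (length stream)

  edge : Pos → Subset n
  edge i = proj₁ (L.lookup stream i)

  W : Pos → ℚ
  W i = proj₂ (L.lookup stream i)

  φBefore : Pos → Duals n
  φBefore i = dualsAfter ε (take (toℕ i) stream)

  Φat : Pos → ℚ
  Φat i = Φ (φBefore i) (edge i)

  pushed : Pos → Bool
  pushed i = pushTest ε (φBefore i) (L.lookup stream i)

  Δφ : Pos → ℚ
  Δφ i = if pushed i then ℕtoℚ ∣ edge i ∣ * (W i - Φat i) else 0ℚ

  intersects : Pos → Pos → Bool
  intersects j i = ⌊ nonempty? (edge j ∩ edge i) ⌋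

  𝒫 : Pos → List Pos
  𝒫 i = i ∷ L.filterᵇ (λ j → ⌊ toℕ j ℕ.<? toℕ i ⌋ ∧ pushed j ∧ intersects j i) (allFin (length stream))

  rank : ℕ
  rank = foldr _⊔_ 0 (map (∣_∣ ∘ proj₁) stream)

{-# OPTIONS --safe #-}
-- A pushed hyperedge c raises each of its |c| ≤ d duals by its residual
-- W'_c = W(c) − Φ_c, which is nonnegative because the duals stay nonnegative
-- and ε ≥ 0; hence Δφ^c ≤ d W'_c.  If c was pushed before e and meets e, it
-- raised some dual of a vertex of e by W'_c, and duals never decrease, so the
-- residuals of these c sum to at most Φ_e.  Therefore
-- Σ_{c ∈ 𝒫(e)} Δφ^c ≤ d (W'_e + Φ_e) = d W(e).
module Submission where

open import Defs
open import Algebra.Bundles using (CommutativeMonoid)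
import Algebra.Properties.CommutativeSemigroup as CommutativeSemigroupProperties
import Algebra.Properties.Group as GroupProperties
open import Data.Bool using (Bool; true; false; if_then_else_; _∧_)
open import Data.Bool.Properties using (∧-conicalˡ; ∧-conicalʳ)
open import Data.Fin using (Fin; toℕ; zero; suc)
open import Data.Fin.Subset using (Subset; Nonempty; ∣_∣; _∩_; _∈_)
open import Data.Fin.Subset.Properties using (nonempty?; x∈p∩q⁻)
import Data.Integer as ℤ
import Data.Integer.Properties as ℤₚ
open import Data.List using (List; []; _∷_; map; foldl; foldr; allFin; take; length; tabulate; filterᵇ; lookup)
open import Data.List.Properties using (map-cong; map-tabulate; tabulate-cong)
open import Data.List.Membership.Propositional using () renaming (_∈_ to _∈ˡ_)
open import Data.List.Membership.Propositional.Properties using (∈-map⁺; ∈-allFin; ∈-lookup)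
open import Data.List.Relation.Unary.All using (All)
open import Data.List.Relation.Unary.Any using (here; there)
open import Data.List.Relation.Unary.Unique.Propositional using (Unique)
open import Data.Nat using (ℕ)
import Data.Nat as ℕ
import Data.Nat.Properties as ℕ
open import Data.Nat.Coprimality using (1-coprimeTo)
import Data.Nat.Coprimality as Coprimality
open import Data.Product using (_,_; proj₁; proj₂)
open import Data.Rational using (ℚ; 0ℚ; 1ℚ; _<_; _≤_; _+_; _-_; -_; _*_; nonNegative; *≤*)
open import Data.Rational.Properties
open import Data.Vec using () renaming (lookup to _‼_)
open import Data.Vec.Properties using ([]=⇒lookup)
open import Function using (_∘_)
open import Function.Bundles using (mk⇔)
open import Relation.Nullary using (Dec; yes; no; does)
open import Relation.Nullary.Decidable using (⌊_⌋; does-⇔; isYes≗does)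
open import Relation.Binary.PropositionalEquality using (_≡_; refl; sym; trans; cong; subst; subst₂; module ≡-Reasoning)

private
  variable
    A : Set
    n : ℕ

p-q+q≡p : ∀ p q → (p - q) + q ≡ p
p-q+q≡p p q = GroupProperties.//-rightDividesˡ +-0-group q p

p≤q⇒0≤q-p : ∀ {p q} → p ≤ q → 0ℚ ≤ q - p
p≤q⇒0≤q-p {p} {q} p≤q = subst (_≤ q - p) (+-inverseʳ p) (+-monoˡ-≤ (- p) p≤q)

p≤p+q : ∀ p {q} → 0ℚ ≤ q → p ≤ p + q
p≤p+q p {q} 0≤q = subst (_≤ p + q) (+-identityʳ p) (+-monoʳ-≤ p 0≤q)

p≤q+p : ∀ p {q} → 0ℚ ≤ q → p ≤ q + p
p≤q+p p {q} 0≤q = subst (_≤ q + p) (+-identityˡ p) (+-monoˡ-≤ p 0≤q)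

p≤[1+r]*p : ∀ {r} p → 0ℚ ≤ r → 0ℚ ≤ p → p ≤ (1ℚ + r) * p
p≤[1+r]*p {r} p 0≤r 0≤p = begin
  p              ≤⟨ p≤p+q p 0≤r*p ⟩
  p + r * p      ≡⟨ cong (_+ r * p) (sym (*-identityˡ p)) ⟩
  1ℚ * p + r * p ≡⟨ sym (*-distribʳ-+ p 1ℚ r) ⟩
  (1ℚ + r) * p   ∎
  where
  open ≤-Reasoning
  0≤r*p : 0ℚ ≤ r * p
  0≤r*p = subst (_≤ r * p) (*-zeroˡ p) (*-monoʳ-≤-nonNeg p {{nonNegative 0≤p}} 0≤r)

ℕtoℚ-nonNeg : ∀ k → 0ℚ ≤ ℕtoℚ k
ℕtoℚ-nonNeg k = nonNegative⁻¹ (ℕtoℚ k) {{normalize-nonNeg k 1}}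

ℕtoℚ-mono-≤ : ∀ {a b} → a ℕ.≤ b → ℕtoℚ a ≤ ℕtoℚ b
ℕtoℚ-mono-≤ {a} {b} a≤b rewrite normalize-coprime (Coprimality.sym (1-coprimeTo a))
                              | normalize-coprime (Coprimality.sym (1-coprimeTo b)) =
  *≤* (subst₂ ℤ._≤_ (sym (ℤₚ.*-identityʳ (ℤ.+ a))) (sym (ℤₚ.*-identityʳ (ℤ.+ b))) (ℤ.+≤+ a≤b))

∈⇒≤foldr-⊔ : ∀ {k ks} → k ∈ˡ ks → k ℕ.≤ foldr ℕ._⊔_ 0 ks
∈⇒≤foldr-⊔ (here refl) = ℕ.m≤m⊔n _ _
∈⇒≤foldr-⊔ (there k∈) = ℕ.m≤n⇒m≤o⊔n _ (∈⇒≤foldr-⊔ k∈)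

-- Not refl: ⌊_⌋ (= isYes) only computes once the decision is in canonical form.
⌊suc<?suc⌋ : ∀ a k → ⌊ ℕ.suc a ℕ.<? ℕ.suc k ⌋ ≡ ⌊ a ℕ.<? k ⌋
⌊suc<?suc⌋ a k = begin
  ⌊ ℕ.suc a ℕ.<? ℕ.suc k ⌋  ≡⟨ isYes≗does (ℕ.suc a ℕ.<? ℕ.suc k) ⟩
  does (ℕ.suc a ℕ.<? ℕ.suc k) ≡⟨ does-⇔ (mk⇔ ℕ.s<s⁻¹ ℕ.s<s) (ℕ.suc a ℕ.<? ℕ.suc k) (a ℕ.<? k) ⟩
  does (a ℕ.<? k)            ≡⟨ sym (isYes≗does (a ℕ.<? k)) ⟩
  ⌊ a ℕ.<? k ⌋              ∎
  where open ≡-Reasoning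

sumℚ-nonNeg : ∀ (f : A → ℚ) → (∀ x → 0ℚ ≤ f x) → ∀ xs → 0ℚ ≤ sumℚ (map f xs)
sumℚ-nonNeg f 0≤f [] = ≤-refl
sumℚ-nonNeg f 0≤f (x ∷ xs) = +-mono-≤ (0≤f x) (sumℚ-nonNeg f 0≤f xs)

sumℚ-mono-≤ : ∀ {f g : A → ℚ} → (∀ x → f x ≤ g x) → ∀ xs → sumℚ (map f xs) ≤ sumℚ (map g xs)
sumℚ-mono-≤ f≤g [] = ≤-refl
sumℚ-mono-≤ f≤g (x ∷ xs) = +-mono-≤ (f≤g x) (sumℚ-mono-≤ f≤g xs)

sumℚ-map-+ : ∀ (f g : A → ℚ) xs → sumℚ (map (λ x → f x + g x) xs) ≡ sumℚ (map f xs) + sumℚ (map g xs)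
sumℚ-map-+ f g [] = refl
sumℚ-map-+ f g (x ∷ xs) = trans (cong (f x + g x +_) (sumℚ-map-+ f g xs)) (interchange (f x) (g x) _ _)
  where open CommutativeSemigroupProperties (CommutativeMonoid.commutativeSemigroup +-0-commutativeMonoid)

sumℚ-map-*ˡ : ∀ c (f : A → ℚ) xs → sumℚ (map (λ x → c * f x) xs) ≡ c * sumℚ (map f xs)
sumℚ-map-*ˡ c f [] = sym (*-zeroʳ c)
sumℚ-map-*ˡ c f (x ∷ xs) = trans (cong (c * f x +_) (sumℚ-map-*ˡ c f xs)) (sym (*-distribˡ-+ c (f x) _))

sumℚ-filterᵇ : ∀ (p : A → Bool) (f : A → ℚ) xs →
  sumℚ (map f (filterᵇ p xs)) ≡ sumℚ (map (λ x → if p x then f x else 0ℚ) xs)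
sumℚ-filterᵇ p f [] = refl
sumℚ-filterᵇ p f (x ∷ xs) with p x
... | true  = cong (f x +_) (sumℚ-filterᵇ p f xs)
... | false = trans (sumℚ-filterᵇ p f xs) (sym (+-identityˡ _))

∈⇒≤sumℚ : ∀ (f : A → ℚ) → (∀ x → 0ℚ ≤ f x) → ∀ {x xs} → x ∈ˡ xs → f x ≤ sumℚ (map f xs)
∈⇒≤sumℚ f 0≤f {xs = x ∷ xs} (here refl) = p≤p+q (f x) (sumℚ-nonNeg f 0≤f xs)
∈⇒≤sumℚ f 0≤f {xs = y ∷ xs} (there x∈) = ≤-trans (∈⇒≤sumℚ f 0≤f x∈) (p≤q+p _ (0≤f y))

sumℚ-zeros : ∀ m → sumℚ (tabulate {n = m} (λ _ → 0ℚ)) ≡ 0ℚ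
sumℚ-zeros ℕ.zero = refl
sumℚ-zeros (ℕ.suc m) = trans (+-identityˡ _) (sumℚ-zeros m)

AllNonNeg : Duals n → Set
AllNonNeg φ = ∀ v → 0ℚ ≤ φ v

masked : Duals n → Subset n → Fin n → ℚ
masked φ s v = if s ‼ v then φ v else 0ℚ

Φ-cong : ∀ {φ ψ : Duals n} → (∀ v → φ v ≡ ψ v) → ∀ s → Φ φ s ≡ Φ ψ s
Φ-cong {n} φ≗ψ s =
  cong sumℚ (map-cong (λ v → cong (λ x → if s ‼ v then x else 0ℚ) (φ≗ψ v)) (allFin n))

Φ-+ : ∀ (φ ψ : Duals n) s → Φ (λ v → φ v + ψ v) s ≡ Φ φ s + Φ ψ s
Φ-+ {n} φ ψ s =
  trans (cong sumℚ (map-cong masked-+ (allFin n))) (sumℚ-map-+ (masked φ s) (masked ψ s) (allFin n))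
  where
  masked-+ : ∀ v → masked (λ v → φ v + ψ v) s v ≡ masked φ s v + masked ψ s v
  masked-+ v with s ‼ v
  ... | true  = refl
  ... | false = refl

masked-nonNeg : ∀ {φ : Duals n} → AllNonNeg φ → ∀ s v → 0ℚ ≤ masked φ s v
masked-nonNeg 0≤φ s v with s ‼ v
... | true  = 0≤φ v
... | false = ≤-refl

Φ-nonNeg : ∀ {φ : Duals n} → AllNonNeg φ → ∀ s → 0ℚ ≤ Φ φ s
Φ-nonNeg {n} 0≤φ s = sumℚ-nonNeg _ (masked-nonNeg 0≤φ s) (allFin n)

∈⇒≤Φ : ∀ {φ : Duals n} → AllNonNeg φ → ∀ {v s} → v ∈ s → φ v ≤ Φ φ s
∈⇒≤Φ {φ = φ} 0≤φ {v} {s} v∈s =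
  subst (_≤ Φ φ s) (cong (λ b → if b then φ v else 0ℚ) ([]=⇒lookup v∈s))
    (∈⇒≤sumℚ (masked φ s) (masked-nonNeg 0≤φ s) (∈-allFin v))

if-≤-*-if : ∀ b {x y} c → (b ≡ true → x ≤ c * y) → (if b then x else 0ℚ) ≤ c * (if b then y else 0ℚ)
if-≤-*-if true  c x≤cy = x≤cy refl
if-≤-*-if false c _    = ≤-reflexive (sym (*-zeroʳ c))

does≡true⇒ : ∀ {P : Set} (P? : Dec P) → does P? ≡ true → P
does≡true⇒ (yes p) _ = p

module Algorithm {n : ℕ} {ε : ℚ} (0≤ε : 0ℚ ≤ ε) where

  residual : Duals n → Edge n → ℚ
  residual φ (t , w) = w - Φ φ t

  pushTest⇒0≤residual : ∀ {φ} → AllNonNeg φ → ∀ e → pushTest ε φ e ≡ true → 0ℚ ≤ residual φ e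
  pushTest⇒0≤residual {φ} 0≤φ (t , w) pushed = p≤q⇒0≤q-p (≤-trans
    (p≤[1+r]*p (Φ φ t) 0≤ε (Φ-nonNeg 0≤φ t))
    (does≡true⇒ ((1ℚ + ε) * Φ φ t ≤? w) pushed))

  step-nonNeg : ∀ {φ} → AllNonNeg φ → ∀ e → AllNonNeg (step ε φ e)
  step-nonNeg {φ} 0≤φ (t , w) v with pushTest ε φ (t , w) in pushed
  ... | false = 0≤φ v
  ... | true with t ‼ v
  ...   | true  = +-mono-≤ (0≤φ v) (pushTest⇒0≤residual 0≤φ (t , w) pushed)
  ...   | false = 0≤φ v

  foldl-step-nonNeg : ∀ {φ} → AllNonNeg φ → ∀ es → AllNonNeg (foldl (step ε) φ es)
  foldl-step-nonNeg 0≤φ [] = 0≤φ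
  foldl-step-nonNeg 0≤φ (e ∷ es) = foldl-step-nonNeg (step-nonNeg 0≤φ e) es

  raise : Subset n → ℚ → Duals n
  raise t r v = if t ‼ v then r else 0ℚ

  raise-nonNeg : ∀ t {r} → 0ℚ ≤ r → AllNonNeg (raise t r)
  raise-nonNeg t 0≤r v with t ‼ v
  ... | true  = 0≤r
  ... | false = ≤-refl

  meets⇒≤Φ-raise : ∀ t s {r} → 0ℚ ≤ r → (if ⌊ nonempty? (t ∩ s) ⌋ then r else 0ℚ) ≤ Φ (raise t r) s
  meets⇒≤Φ-raise t s {r} 0≤r with nonempty? (t ∩ s)
  ... | no _ = Φ-nonNeg (raise-nonNeg t 0≤r) s
  ... | yes (v , v∈t∩s) = let v∈t , v∈s = x∈p∩q⁻ t s v∈t∩s in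
    subst (_≤ Φ (raise t r) s) (cong (λ b → if b then r else 0ℚ) ([]=⇒lookup v∈t))
      (∈⇒≤Φ (raise-nonNeg t 0≤r) v∈s)

  updated≗φ+raise : ∀ (φ : Duals n) t r v → (if t ‼ v then φ v + r else φ v) ≡ φ v + raise t r v
  updated≗φ+raise φ t r v with t ‼ v
  ... | true  = refl
  ... | false = sym (+-identityʳ (φ v))

  Φ-step-≥ : ∀ {φ} → AllNonNeg φ → ∀ t w s →
    (if pushTest ε φ (t , w) ∧ ⌊ nonempty? (t ∩ s) ⌋ then residual φ (t , w) else 0ℚ) + Φ φ s
      ≤ Φ (step ε φ (t , w)) s
  Φ-step-≥ {φ} 0≤φ t w s with pushTest ε φ (t , w) in pushed
  ... | false = ≤-reflexive (+-identityˡ (Φ φ s))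
  ... | true = begin
    (if ⌊ nonempty? (t ∩ s) ⌋ then r else 0ℚ) + Φ φ s
      ≤⟨ +-monoˡ-≤ (Φ φ s) (meets⇒≤Φ-raise t s (pushTest⇒0≤residual 0≤φ (t , w) pushed)) ⟩
    Φ (raise t r) s + Φ φ s         ≡⟨ +-comm (Φ (raise t r) s) (Φ φ s) ⟩
    Φ φ s + Φ (raise t r) s         ≡⟨ sym (Φ-+ φ (raise t r) s) ⟩
    Φ (λ v → φ v + raise t r v) s   ≡⟨ sym (Φ-cong (updated≗φ+raise φ t r) s) ⟩
    Φ (λ v → if t ‼ v then φ v + r else φ v) s ∎
    where
    open ≤-Reasoning
    r = residual φ (t , w)

  dualsBefore : Duals n → List (Edge n) → ℕ → Duals n
  dualsBefore φ₀ es k = foldl (step ε) φ₀ (take k es)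

  meetingResidual : Duals n → (es : List (Edge n)) → ℕ → Subset n → Fin (length es) → ℚ
  meetingResidual φ₀ es k s j =
    if ⌊ toℕ j ℕ.<? k ⌋ ∧ pushTest ε φⱼ eⱼ ∧ ⌊ nonempty? (proj₁ eⱼ ∩ s) ⌋ then residual φⱼ eⱼ else 0ℚ
    where
    φⱼ = dualsBefore φ₀ es (toℕ j)
    eⱼ = lookup es j

  -- Generalised to any nonnegative start φ₀ so that the induction can peel off the first edge.
  Φ-dualsBefore-≥ : ∀ {φ₀} → AllNonNeg φ₀ → ∀ es k s →
    sumℚ (tabulate (meetingResidual φ₀ es k s)) + Φ φ₀ s ≤ Φ (dualsBefore φ₀ es k) s
  Φ-dualsBefore-≥ {φ₀} 0≤φ₀ [] ℕ.zero s = ≤-reflexive (+-identityˡ (Φ φ₀ s))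
  Φ-dualsBefore-≥ {φ₀} 0≤φ₀ [] (ℕ.suc k) s = ≤-reflexive (+-identityˡ (Φ φ₀ s))
  Φ-dualsBefore-≥ {φ₀} 0≤φ₀ (e ∷ es) ℕ.zero s =
    ≤-reflexive (trans (cong (_+ Φ φ₀ s) (sumℚ-zeros (ℕ.suc (length es)))) (+-identityˡ (Φ φ₀ s)))
  Φ-dualsBefore-≥ {φ₀} 0≤φ₀ (e@(t , w) ∷ es) (ℕ.suc k) s = begin
    (g zero + sumℚ (tabulate (g ∘ suc))) + Φ φ₀ s ≡⟨ cong (λ x → (g zero + x) + Φ φ₀ s) shift ⟩
    (g zero + R) + Φ φ₀ s                         ≡⟨ +-comm-assoc ⟩
    R + (g zero + Φ φ₀ s)                         ≤⟨ +-monoʳ-≤ R (Φ-step-≥ 0≤φ₀ t w s) ⟩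
    R + Φ (step ε φ₀ e) s                         ≤⟨ Φ-dualsBefore-≥ (step-nonNeg 0≤φ₀ e) es k s ⟩
    Φ (dualsBefore φ₀ (e ∷ es) (ℕ.suc k)) s       ∎
    where
    open ≤-Reasoning
    g = meetingResidual φ₀ (e ∷ es) (ℕ.suc k) s
    R = sumℚ (tabulate (meetingResidual (step ε φ₀ e) es k s))
    shift : sumℚ (tabulate (g ∘ suc)) ≡ R
    shift = cong sumℚ (tabulate-cong g∘suc≗)
      where
      g∘suc≗ : ∀ j → g (suc j) ≡ meetingResidual (step ε φ₀ e) es k s j
      g∘suc≗ j rewrite ⌊suc<?suc⌋ (toℕ j) k = refl
    +-comm-assoc : (g zero + R) + Φ φ₀ s ≡ R + (g zero + Φ φ₀ s)
    +-comm-assoc = trans (cong (_+ Φ φ₀ s) (+-comm (g zero) R)) (+-assoc R (g zero) (Φ φ₀ s))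

module RunBounds {n : ℕ} {ε : ℚ} (0≤ε : 0ℚ ≤ ε) (stream : List (Edge n)) where
  open Run ε stream
  open Algorithm {n} 0≤ε

  d : ℚ
  d = ℕtoℚ rank

  residualAt : Pos → ℚ
  residualAt j = residual (φBefore j) (lookup stream j)

  φBefore-nonNeg : ∀ j → AllNonNeg (φBefore j)
  φBefore-nonNeg j = foldl-step-nonNeg (λ _ → ≤-refl) (take (toℕ j) stream)

  Δφ≤rank*residual : ∀ j → pushed j ≡ true → Δφ j ≤ d * residualAt j
  Δφ≤rank*residual j pushed-j rewrite pushed-j =
    *-monoʳ-≤-nonNeg (residualAt j)
      {{nonNegative (pushTest⇒0≤residual (φBefore-nonNeg j) (lookup stream j) pushed-j)}}
      (ℕtoℚ-mono-≤ (∈⇒≤foldr-⊔ (∈-map⁺ (∣_∣ ∘ proj₁) (∈-lookup {xs = stream} j))))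

  earlierMeeting : Pos → Pos → Bool
  earlierMeeting i j = ⌊ toℕ j ℕ.<? toℕ i ⌋ ∧ pushed j ∧ intersects j i

  Σ-earlierMeeting-Δφ≤rank*Φat : ∀ i →
    sumℚ (map Δφ (filterᵇ (earlierMeeting i) (allFin (length stream)))) ≤ d * Φat i
  Σ-earlierMeeting-Δφ≤rank*Φat i = begin
    sumℚ (map Δφ (filterᵇ P js))                     ≡⟨ sumℚ-filterᵇ P Δφ js ⟩
    sumℚ (map (λ j → if P j then Δφ j else 0ℚ) js)   ≤⟨ sumℚ-mono-≤ pointwise js ⟩
    sumℚ (map (λ j → d * m j) js)                    ≡⟨ sumℚ-map-*ˡ d m js ⟩
    d * sumℚ (map m js)                              ≡⟨ cong (λ ms → d * sumℚ ms) (map-tabulate (λ j → j) m) ⟩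
    d * sumℚ (tabulate m)                            ≤⟨ *-monoˡ-≤-nonNeg d {{d≥0}} Σm≤Φat ⟩
    d * Φat i                                        ∎
    where
    open ≤-Reasoning
    d≥0 = nonNegative (ℕtoℚ-nonNeg rank)
    P = earlierMeeting i
    js = allFin (length stream)
    m = meetingResidual (λ _ → 0ℚ) stream (toℕ i) (edge i)
    Σm≤Φat : sumℚ (tabulate m) ≤ Φat i
    Σm≤Φat = ≤-trans (p≤p+q _ (Φ-nonNeg (λ _ → ≤-refl) (edge i)))
                     (Φ-dualsBefore-≥ (λ _ → ≤-refl) stream (toℕ i) (edge i))
    pointwise : ∀ j → (if P j then Δφ j else 0ℚ) ≤ d * m j
    pointwise j = if-≤-*-if (P j) d λ Pj≡true →
      Δφ≤rank*residual j (∧-conicalˡ (pushed j) _ (∧-conicalʳ ⌊ toℕ j ℕ.<? toℕ i ⌋ _ Pj≡true))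

lemma1 : (n : ℕ) (ε : ℚ) (stream : List (Edge n)) →
  0ℚ ≤ ε →
  All (λ e → 0ℚ < proj₂ e) stream →
  All (λ e → Nonempty (proj₁ e)) stream →
  Unique (map proj₁ stream) →
  (i : Run.Pos ε stream) → Run.pushed ε stream i ≡ true →
  sumℚ (map (Run.Δφ ε stream) (Run.𝒫 ε stream i)) ≤ ℕtoℚ (Run.rank ε stream) * Run.W ε stream i
lemma1 n ε stream 0≤ε _ _ _ i pushed-i = begin
  Δφ i + sumℚ (map Δφ (filterᵇ (earlierMeeting i) (allFin (length stream))))
    ≤⟨ +-mono-≤ (Δφ≤rank*residual i pushed-i) (Σ-earlierMeeting-Δφ≤rank*Φat i) ⟩
  d * (W i - Φat i) + d * Φat i  ≡⟨ sym (*-distribˡ-+ d (W i - Φat i) (Φat i)) ⟩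
  d * (W i - Φat i + Φat i)      ≡⟨ cong (d *_) (p-q+q≡p (W i) (Φat i)) ⟩
  d * W i                        ∎
  where
  open ≤-Reasoning
  open Run ε stream
  open RunBounds 0≤ε stream
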